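{- Let $D=(V,A)$ be a finite loopless digraph, $F\subseteq A$ a non-empty set of edges, $B$ an integral $0$-base-polyhedron, and $f:A\to\mathbb{Z}\cup\{ -\infty\}$, $g:A\to\mathbb{Z}\cup\{+\infty\}$ with $f\le g$ such that $Q(f,g;B)\cap\mathbb{Z}^A$ is non-empty. Then there is a function $g^-\le g$ on $A$ which is finite-valued on $F$ such that the (possibly empty) set of $F$-dec-min elements of $Q(f,g;B)\cap\mathbb{Z}^A$ equals the set of $F$-dec-min elements of $Q(f,g^-;B)\cap\mathbb{Z}^A$.
   Context: For $x\in\mathbb{R}^V$, $\widetilde x(Z)=\sum_{v\in Z}x(v)$. A base-polyhedron is $B'(p)=\{x:\widetilde x(V)=p(V),\ \widetilde x(Z)\ge p(Z)\ \forall Z\subset V\}$ with $p:2^V\to\mathbb{Z}\cup\{ -\infty\}$, $p(\emptyset)=0$, $p(V)$ finite, $p(X)+p(Y)\le p(X\cap Y)+p(X\cup Y)$; it is a $0$-base-polyhedron when $p(V)=0$ and integral when $p$ is integer-valued where finite. For $x:A\to\mathbb{R}$, $\psi_x(v)=\sum_{uv\in A}x(uv)-\sum_{vu\in A}x(vu)$; $Q(f,g;B)=\{x\in\mathbb{R}^A:f\le x\le g,\ \psi_x\in B\}$. For $y,y'\in\mathbb{R}^F$, $y$ is decreasingly smaller than $y'$ if its decreasingly sorted component sequence is lexicographically smaller; $z\in S$ is $F$-dec-min in $S$ if no $z'\in S$ has $z'|_F$ decreasingly smaller than $z|_F$. -}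

module Defs where

open import Data.Nat using (ℕ)
open import Data.Integer as ℤ using (ℤ; _+_; _-_; _≤_; _<_; 0ℤ)
import Data.Integer.Properties as ℤP
open import Data.Fin.Subset.Properties using (_∈?_)
open import Data.Fin using (Fin; zero; suc; _≟_)
open import Data.Fin.Subset using (Subset; _∈_; ⊤; ⊥; _∩_; _∪_; Nonempty)
open import Data.Vec using (Vec; []; _∷_)
open import Data.List using (List; []; _∷_)
open import Data.Bool using (true; false)
open import Data.Unit using () renaming (⊤ to Unit)
open import Data.Product using (Σ; _×_; ∃; ∃-syntax)
open import Relation.Nullary using (¬_; yes; no)
open import Relation.Binary.PropositionalEquality using (_≡_; _≢_)
open import Relation.Binary.Properties.DecTotalOrder ℤP.≤-decTotalOrder using (≥-decTotalOrder)
open import Data.List.Sort ≥-decTotalOrder using (sort)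
open import Data.List.Relation.Binary.Lex.Strict using (Lex-<)

data ℤ₋∞ : Set where
  -∞  : ℤ₋∞
  fin : ℤ → ℤ₋∞

data ℤ₊∞ : Set where
  +∞  : ℤ₊∞
  fin : ℤ → ℤ₊∞

_≤ₗ_ : ℤ₋∞ → ℤ → Set
-∞    ≤ₗ x = Unit
fin l ≤ₗ x = l ≤ x

_≤ᵤ_ : ℤ → ℤ₊∞ → Set
x ≤ᵤ +∞    = Unit
x ≤ᵤ fin u = x ≤ u

_≤ₗᵤ_ : ℤ₋∞ → ℤ₊∞ → Set
-∞    ≤ₗᵤ u = Unit
fin l ≤ₗᵤ u = l ≤ᵤ u

_≤ᵤᵤ_ : ℤ₊∞ → ℤ₊∞ → Set
u     ≤ᵤᵤ +∞     = Unit
+∞    ≤ᵤᵤ fin u' = Data.Empty.⊥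
  where import Data.Empty
fin u ≤ᵤᵤ fin u' = u ≤ u'

IsFinite : ℤ₊∞ → Set
IsFinite u = ∃[ k ] u ≡ fin k

∑ : ∀ {m} → (Fin m → ℤ) → ℤ
∑ {ℕ.zero}  x = 0ℤ
∑ {ℕ.suc m} x = x zero + ∑ (λ i → x (suc i))

sumOver : ∀ {n} → (Fin n → ℤ) → Subset n → ℤ
sumOver {n} x Z = ∑ (λ v → indicator v)
  where
  indicator : Fin n → ℤ
  indicator v with v ∈? Z
  ... | yes _ = x v
  ... | no  _ = 0ℤ

-- Digraphs: V = Fin n, A = Fin m; arc a goes from tl a to hd a.

record Digraph (n m : ℕ) : Set where
  field
    tl : Fin m → Fin n
    hd : Fin m → Fin n

Loopless : ∀ {n m} → Digraph n m → Set
Loopless D = ∀ a → Digraph.tl D a ≢ Digraph.hd D a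

ψ : ∀ {n m} → Digraph n m → (Fin m → ℤ) → Fin n → ℤ
ψ {n} {m} D x v = ∑ inPart - ∑ outPart
  where
  open Digraph D
  inPart : Fin m → ℤ
  inPart a with hd a ≟ v
  ... | yes _ = x a
  ... | no  _ = 0ℤ
  outPart : Fin m → ℤ
  outPart a with tl a ≟ v
  ... | yes _ = x a
  ... | no  _ = 0ℤ

-- p(X)+p(Y) ≤ p(X∩Y)+p(X∪Y), with -∞ absorbing on both sides
-- (so the inequality only constrains the case p(X), p(Y) finite).
Supermodular : ∀ {n} → (Subset n → ℤ₋∞) → Set
Supermodular p = ∀ X Y a b → p X ≡ fin a → p Y ≡ fin b →
  ∃[ c ] ∃[ d ] (p (X ∩ Y) ≡ fin c × p (X ∪ Y) ≡ fin d × a + b ≤ c + d)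

-- p defines an integral 0-base-polyhedron: p(∅) = 0, p(V) = 0 (finite),
-- supermodular; integral since finite values are integers.
Is0BaseFunction : ∀ {n} → (Subset n → ℤ₋∞) → Set
Is0BaseFunction p = p ⊥ ≡ fin 0ℤ × p ⊤ ≡ fin 0ℤ × Supermodular p

InBase : ∀ {n} → (Subset n → ℤ₋∞) → (Fin n → ℤ) → Set
InBase p y = (∀ c → p ⊤ ≡ fin c → sumOver y ⊤ ≡ c)
           × (∀ Z → p Z ≤ₗ sumOver y Z)

InQ : ∀ {n m} → Digraph n m → (Fin m → ℤ₋∞) → (Fin m → ℤ₊∞) →
      (Subset n → ℤ₋∞) → (Fin m → ℤ) → Set
InQ D f g p x = (∀ a → f a ≤ₗ x a) × (∀ a → x a ≤ᵤ g a) × InBase p (ψ D x)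

restrict : ∀ {m} → Subset m → (Fin m → ℤ) → List ℤ
restrict {ℕ.zero}  []      x = []
restrict {ℕ.suc m} (true  ∷ F) x = x zero ∷ restrict F (λ i → x (suc i))
restrict {ℕ.suc m} (false ∷ F) x = restrict F (λ i → x (suc i))

sortDec : List ℤ → List ℤ
sortDec = sort

DecSmaller : ∀ {m} → Subset m → (Fin m → ℤ) → (Fin m → ℤ) → Set
DecSmaller F y y' = Lex-< _≡_ _<_ (sortDec (restrict F y)) (sortDec (restrict F y'))

DecMin : ∀ {m} → Subset m → ((Fin m → ℤ) → Set) → (Fin m → ℤ) → Set
DecMin F S z = S z × (∀ z' → S z' → ¬ DecSmaller F z' z)

{-# OPTIONS --safe #-}
-- Fix an integral x₀ ∈ Q(f,g;B) and let β be its largest component on F.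
-- An F-dec-min element z cannot exceed β on F: its largest F-component
-- would then exceed that of x₀, making x₀ decreasingly smaller than z.
-- Conversely, whatever is decreasingly smaller than z has largest
-- F-component at most that of z, hence at most β.  So capping g at β on F
-- loses no dec-min element and creates no new one.
module Submission where

open import Defs
open import Data.Nat using (ℕ)
open import Data.Integer using (ℤ; 0ℤ; _⊓_; _≤_; _<_; _≤?_)
import Data.Integer.Properties as ℤP
open import Data.Fin using (Fin; zero; suc)
open import Data.Fin.Subset using (Subset; _∈_; Nonempty)
open import Data.Fin.Subset.Properties using (_∈?_)
open import Data.Vec using (_∷_)
open import Data.Vec.Base using (here; there)
open import Data.Bool using (true; false)
open import Data.List using (List; []; _∷_)
open import Data.List.Membership.Propositional using () renaming (_∈_ to _∈ₗ_)
open import Data.List.Relation.Unary.Any using (here; there)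
open import Data.List.Relation.Unary.Linked using (Linked; _∷_)
open import Data.List.Relation.Binary.Permutation.Propositional using (↭-sym)
open import Data.List.Relation.Binary.Permutation.Propositional.Properties using (∈-resp-↭)
open import Data.List.Relation.Binary.Lex.Core using (halt; this; next; Lex-<)
open import Data.Product using (_×_; ∃-syntax; _,_; proj₁; proj₂)
open import Data.Unit using (tt)
open import Data.Empty using (⊥-elim)
open import Relation.Nullary using (Dec; yes; no)
open import Relation.Binary.PropositionalEquality using (_≡_; refl; sym; subst)
open import Relation.Binary.Properties.DecTotalOrder ℤP.≤-decTotalOrder using (≥-decTotalOrder)
open import Data.List.Sort ≥-decTotalOrder using (sort-↭; sort-↗)

private
  variable
    m : ℕ

-- The junk value 0 for the empty list is never inspected: every use below
-- comes with a member of the list.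
headOr0 : List ℤ → ℤ
headOr0 []      = 0ℤ
headOr0 (v ∷ _) = v

DecSorted : List ℤ → Set
DecSorted = Linked (λ u v → v ≤ u)

∈⇒≤-headOr0 : ∀ {xs v} → DecSorted xs → v ∈ₗ xs → v ≤ headOr0 xs
∈⇒≤-headOr0                 _       (here refl) = ℤP.≤-refl
∈⇒≤-headOr0 {_ ∷ _ ∷ _} (r ∷ sorted) (there v∈) = ℤP.≤-trans (∈⇒≤-headOr0 sorted v∈) r

headOr0-∈ : ∀ {xs v} → v ∈ₗ xs → headOr0 xs ∈ₗ xs
headOr0-∈ {_ ∷ _} _ = here refl

Lex-<⇒headOr0-≤ : ∀ {xs ys v} → v ∈ₗ xs → Lex-< _≡_ _<_ xs ys → headOr0 xs ≤ headOr0 ys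
Lex-<⇒headOr0-≤ _ (this x<y)    = ℤP.<⇒≤ x<y
Lex-<⇒headOr0-≤ _ (next refl _) = ℤP.≤-refl

headOr0-<⇒Lex-< : ∀ xs {ys v} → v ∈ₗ ys → headOr0 xs < headOr0 ys → Lex-< _≡_ _<_ xs ys
headOr0-<⇒Lex-< []      {_ ∷ _} _ _  = halt
headOr0-<⇒Lex-< (_ ∷ _) {_ ∷ _} _ lt = this lt

∈⇒∈-restrict : ∀ (F : Subset m) y {a} → a ∈ F → y a ∈ₗ restrict F y
∈⇒∈-restrict (true  ∷ F) y here       = here refl
∈⇒∈-restrict (true  ∷ F) y (there a∈) = there (∈⇒∈-restrict F (λ i → y (suc i)) a∈)
∈⇒∈-restrict (false ∷ F) y (there a∈) = ∈⇒∈-restrict F (λ i → y (suc i)) a∈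

∈-restrict⇒∈ : ∀ (F : Subset m) y {v} → v ∈ₗ restrict F y → ∃[ a ] (a ∈ F × v ≡ y a)
∈-restrict⇒∈ (true ∷ F) y (here v≡) = zero , here , v≡
∈-restrict⇒∈ (true ∷ F) y (there v∈) with ∈-restrict⇒∈ F (λ i → y (suc i)) v∈
... | a , a∈ , v≡ = suc a , there a∈ , v≡
∈-restrict⇒∈ (false ∷ F) y v∈ with ∈-restrict⇒∈ F (λ i → y (suc i)) v∈
... | a , a∈ , v≡ = suc a , there a∈ , v≡

maxOn : Subset m → (Fin m → ℤ) → ℤ
maxOn F y = headOr0 (sortDec (restrict F y))

∈-sortDec : ∀ (F : Subset m) y {a} → a ∈ F → y a ∈ₗ sortDec (restrict F y)
∈-sortDec F y a∈ = ∈-resp-↭ (↭-sym (sort-↭ (restrict F y))) (∈⇒∈-restrict F y a∈)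

≤-maxOn : ∀ (F : Subset m) y {a} → a ∈ F → y a ≤ maxOn F y
≤-maxOn F y a∈ = ∈⇒≤-headOr0 (sort-↗ (restrict F y)) (∈-sortDec F y a∈)

maxOn-attained : ∀ (F : Subset m) y → Nonempty F → ∃[ a ] (a ∈ F × maxOn F y ≡ y a)
maxOn-attained F y (_ , a∈) =
  ∈-restrict⇒∈ F y (∈-resp-↭ (sort-↭ (restrict F y)) (headOr0-∈ (∈-sortDec F y a∈)))

BoundedOn : Subset m → ℤ → (Fin m → ℤ) → Set
BoundedOn F β y = ∀ a → a ∈ F → y a ≤ β

maxOn-least : ∀ (F : Subset m) {β} y → Nonempty F → BoundedOn F β y → maxOn F y ≤ β
maxOn-least F y ne bounded with maxOn-attained F y ne
... | a , a∈ , max≡ = subst (_≤ _) (sym max≡) (bounded a a∈)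

DecSmaller⇒maxOn-≤ : ∀ (F : Subset m) {y y'} → Nonempty F →
                     DecSmaller F y y' → maxOn F y ≤ maxOn F y'
DecSmaller⇒maxOn-≤ F {y} (_ , a∈) = Lex-<⇒headOr0-≤ (∈-sortDec F y a∈)

maxOn-<⇒DecSmaller : ∀ (F : Subset m) {y y'} → Nonempty F →
                     maxOn F y < maxOn F y' → DecSmaller F y y'
maxOn-<⇒DecSmaller F {y} {y'} (_ , a∈) = headOr0-<⇒Lex-< _ (∈-sortDec F y' a∈)

DecMin-boundedOn : ∀ (F : Subset m) {β} (S T : (Fin m → ℤ) → Set) → Nonempty F →
  (∀ y → T y → S y × BoundedOn F β y) →
  (∀ y → S y → BoundedOn F β y → T y) →
  (∃[ x₀ ] (S x₀ × BoundedOn F β x₀)) →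
  ∀ z → (DecMin F S z → DecMin F T z) × (DecMin F T z → DecMin F S z)
DecMin-boundedOn F {β} S T ne T⇒S S⇒T (x₀ , Sx₀ , x₀≤β) z = toT , toS
  where
  toT : DecMin F S z → DecMin F T z
  toT (Sz , minS) = S⇒T z Sz z≤β , λ z' Tz' → minS z' (proj₁ (T⇒S z' Tz'))
    where
    z≤β : BoundedOn F β z
    z≤β a a∈ with z a ≤? β
    ... | yes za≤β = za≤β
    ... | no  za≰β = ⊥-elim (minS x₀ Sx₀ (maxOn-<⇒DecSmaller F ne (begin-strict
      maxOn F x₀ ≤⟨ maxOn-least F x₀ ne x₀≤β ⟩
      β          <⟨ ℤP.≰⇒> za≰β ⟩
      z a        ≤⟨ ≤-maxOn F z a∈ ⟩
      maxOn F z  ∎)))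
      where open ℤP.≤-Reasoning

  toS : DecMin F T z → DecMin F S z
  toS (Tz , minT) with T⇒S z Tz
  ... | Sz , z≤β = Sz , λ z' Sz' z'<z → minT z' (S⇒T z' Sz' (z'≤β z' z'<z)) z'<z
    where
    z'≤β : ∀ z' → DecSmaller F z' z → BoundedOn F β z'
    z'≤β z' z'<z a a∈ = begin
      z' a        ≤⟨ ≤-maxOn F z' a∈ ⟩
      maxOn F z'  ≤⟨ DecSmaller⇒maxOn-≤ F ne z'<z ⟩
      maxOn F z   ≤⟨ maxOn-least F z ne z≤β ⟩
      β           ∎
      where open ℤP.≤-Reasoning

cap : ℤ → ℤ₊∞ → ℤ₊∞
cap β +∞      = fin β
cap β (fin u) = fin (u ⊓ β)

capWhen : ∀ {P : Set} → Dec P → ℤ → ℤ₊∞ → ℤ₊∞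
capWhen (yes _) β u = cap β u
capWhen (no  _) β u = u

capOn : Subset m → ℤ → (Fin m → ℤ₊∞) → Fin m → ℤ₊∞
capOn F β g a = capWhen (a ∈? F) β (g a)

≤ᵤᵤ-refl : ∀ u → u ≤ᵤᵤ u
≤ᵤᵤ-refl +∞      = tt
≤ᵤᵤ-refl (fin u) = ℤP.≤-refl

capWhen-≤ᵤᵤ : ∀ {P} (d : Dec P) β u → capWhen d β u ≤ᵤᵤ u
capWhen-≤ᵤᵤ (yes _) β +∞      = tt
capWhen-≤ᵤᵤ (yes _) β (fin u) = ℤP.i⊓j≤i u β
capWhen-≤ᵤᵤ (no  _) β u       = ≤ᵤᵤ-refl u

capWhen-finite : ∀ {P} (d : Dec P) β u → P → IsFinite (capWhen d β u)
capWhen-finite (yes _) β +∞      _ = β , refl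
capWhen-finite (yes _) β (fin u) _ = u ⊓ β , refl
capWhen-finite (no ¬p) β u       p = ⊥-elim (¬p p)

≤ᵤ-capWhen⁺ : ∀ {P} (d : Dec P) β u {x} → x ≤ᵤ u → (P → x ≤ β) → x ≤ᵤ capWhen d β u
≤ᵤ-capWhen⁺ (yes p) β +∞      _   x≤β = x≤β p
≤ᵤ-capWhen⁺ (yes p) β (fin u) x≤u x≤β = ℤP.⊓-glb x≤u (x≤β p)
≤ᵤ-capWhen⁺ (no  _) β u       x≤u _   = x≤u

≤ᵤ-capWhen⁻ : ∀ {P} (d : Dec P) β u {x} → x ≤ᵤ capWhen d β u → x ≤ᵤ u × (P → x ≤ β)
≤ᵤ-capWhen⁻ (yes _) β +∞      x≤β = tt , λ _ → x≤β
≤ᵤ-capWhen⁻ (yes _) β (fin u) x≤c =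
  ℤP.≤-trans x≤c (ℤP.i⊓j≤i u β) , λ _ → ℤP.≤-trans x≤c (ℤP.i⊓j≤j u β)
≤ᵤ-capWhen⁻ (no ¬p) β u       x≤u = x≤u , λ p → ⊥-elim (¬p p)

module _ {n} (D : Digraph n m) (f : Fin m → ℤ₋∞) (g : Fin m → ℤ₊∞)
         (p : Subset n → ℤ₋∞) (F : Subset m) (β : ℤ) where

  InQ-capOn⁺ : ∀ y → InQ D f g p y → BoundedOn F β y → InQ D f (capOn F β g) p y
  InQ-capOn⁺ y (y≥f , y≤g , ψy∈B) y≤β =
    y≥f , (λ a → ≤ᵤ-capWhen⁺ (a ∈? F) β (g a) (y≤g a) (y≤β a)) , ψy∈B

  InQ-capOn⁻ : ∀ y → InQ D f (capOn F β g) p y → InQ D f g p y × BoundedOn F β y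
  InQ-capOn⁻ y (y≥f , y≤cap , ψy∈B) =
    (y≥f , (λ a → proj₁ (y≤cap⁻ a)) , ψy∈B) , (λ a → proj₂ (y≤cap⁻ a))
    where
    y≤cap⁻ : ∀ a → y a ≤ᵤ g a × (a ∈ F → y a ≤ β)
    y≤cap⁻ a = ≤ᵤ-capWhen⁻ (a ∈? F) β (g a) (y≤cap a)

lemma6p1 : (n m : ℕ) (D : Digraph n m) → Loopless D →
    (F : Subset m) → Nonempty F →
    (p : Subset n → ℤ₋∞) → Is0BaseFunction p →
    (f : Fin m → ℤ₋∞) (g : Fin m → ℤ₊∞) → (∀ a → f a ≤ₗᵤ g a) →
    (∃[ x ] InQ D f g p x) →
    ∃[ g⁻ ] ((∀ a → g⁻ a ≤ᵤᵤ g a)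
           × (∀ a → a ∈ F → IsFinite (g⁻ a))
           × (∀ z → (DecMin F (InQ D f g p) z → DecMin F (InQ D f g⁻ p) z)
                  × (DecMin F (InQ D f g⁻ p) z → DecMin F (InQ D f g p) z)))
lemma6p1 n m D _ F ne p _ f g _ (x₀ , x₀∈Q) =
  capOn F β g ,
  (λ a → capWhen-≤ᵤᵤ (a ∈? F) β (g a)) ,
  (λ a → capWhen-finite (a ∈? F) β (g a)) ,
  DecMin-boundedOn F (InQ D f g p) (InQ D f (capOn F β g) p) ne
    (InQ-capOn⁻ D f g p F β) (InQ-capOn⁺ D f g p F β)
    (x₀ , x₀∈Q , λ a → ≤-maxOn F x₀)
  where
  β : ℤ
  β = maxOn F x₀
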